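{- For every $n\ge 1$, $$\sum_{T\in\mathcal{P}_n}x^{\mathsf{odd}(T)}y^{\mathsf{oe}(T)}z^{\mathsf{ee}(T)}=\sum_{T\in\mathcal{P}_n}x^{\mathsf{oe}(T)}y^{\mathsf{odd}(T)}z^{\mathsf{ee}(T)}.$$
   Context: $\mathcal{P}_n$ is the set of plane trees (rooted trees in which the children of each node are linearly ordered) with $n$ edges. The degree of a node is its number of children; the level of a node is its distance from the root (root at level $0$). $\mathsf{odd}(T)$ is the number of odd-degree nodes of $T$; $\mathsf{oe}(T)$ (resp. $\mathsf{ee}(T)$) is the number of even-degree nodes on odd (resp. even) levels of $T$. -}

module Defs where

open import Data.Nat using (ℕ; zero; suc; _+_; _≟_)
open import Data.Bool using (Bool; true; false; not; _∧_; if_then_else_)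
open import Data.List using (List; []; _∷_; length; filter)
open import Data.Product using (_×_; _,_)
open import Data.Product.Properties using (≡-dec)
open import Relation.Binary.PropositionalEquality using (_≡_)
open import Relation.Nullary using (Dec)

-- Plane trees: a node together with the linearly ordered list of its subtrees.
data Tree : Set where
  node : List Tree → Tree

isOdd : ℕ → Bool
isOdd zero = false
isOdd (suc n) = not (isOdd n)

isEven : ℕ → Bool
isEven n = not (isOdd n)

one? : Bool → ℕ
one? b = if b then 1 else 0

degree : Tree → ℕ
degree (node ts) = length ts

mutual
  edges : Tree → ℕ
  edges (node ts) = edgesF ts

  edgesF : List Tree → ℕ
  edgesF [] = 0
  edgesF (t ∷ ts) = suc (edges t + edgesF ts)

mutual
  odd : Tree → ℕ
  odd (node ts) = one? (isOdd (length ts)) + oddF ts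

  oddF : List Tree → ℕ
  oddF [] = 0
  oddF (t ∷ ts) = odd t + oddF ts

-- evenDegAt b T : number of even-degree nodes of T whose level is even
-- (if b = true) resp. odd (if b = false), levels measured from the root of T.
mutual
  evenDegAt : Bool → Tree → ℕ
  evenDegAt b (node ts) = one? (b ∧ isEven (length ts)) + evenDegAtF (not b) ts

  evenDegAtF : Bool → List Tree → ℕ
  evenDegAtF b [] = 0
  evenDegAtF b (t ∷ ts) = evenDegAt b t + evenDegAtF b ts

ee : Tree → ℕ
ee = evenDegAt true

oe : Tree → ℕ
oe = evenDegAt false

_≟₃_ : (p q : ℕ × ℕ × ℕ) → Dec (p ≡ q)
_≟₃_ = ≡-dec _≟_ (≡-dec _≟_ _≟_)

-- coefficient of x^a y^b z^c in  Σ_{T ∈ L} x^{f T} y^{g T} z^{h T}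
coeff : (Tree → ℕ) → (Tree → ℕ) → (Tree → ℕ) → List Tree → ℕ → ℕ → ℕ → ℕ
coeff f g h L a b c = length (filter (λ T → (f T , g T , h T) ≟₃ (a , b , c)) L)

-- The symmetry is realised by an involution ψ on plane trees that preserves
-- the number of edges and ee and exchanges odd with oe.  If the root's
-- children are  node K ∷ rest,  those of the root of ψ are
--   node (map ψ (rotate rest)) ∷ rotate (map ψ K),
-- where  rotate (t ∷ ts) = node ts ∷ children t  is an involution.  Rotation
-- moves the subtrees of t one level up and those of ts one level down, so it
-- exchanges the counts of even-degree nodes on even and on odd levels, while
-- it preserves the number of odd-degree nodes once the root is counted with
-- one extra child.  Composed with map ψ, which exchanges odd and oe by
-- induction, this gives the exchange for ψ.
module Submission where

open import Defs
open import Data.Nat.Properties using (+-comm; +-commutativeSemigroup)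
open import Algebra.Properties.CommutativeSemigroup +-commutativeSemigroup
  using (x∙yz≈y∙xz; x∙yz≈xz∙y; xy∙z≈x∙zy)
open import Data.Bool using (false; true)
open import Data.Bool.Properties using (not-involutive)
open import Data.List using (List; []; _∷_; length; map; filter)
open import Data.List.Membership.Propositional using (_∈_)
open import Data.List.Membership.Propositional.Properties using (∈-map⁺; ∈-map⁻)
open import Data.List.Membership.Propositional.Properties.WithK using (unique∧set⇒bag)
open import Data.List.Properties using (filter-accept; filter-reject)
open import Data.List.Relation.Binary.BagAndSetEquality using (∼bag⇒↭)
open import Data.List.Relation.Binary.Permutation.Propositional using (_↭_)
open import Data.List.Relation.Binary.Permutation.Propositional.Properties
  using (↭-length; filter-↭)
open import Data.List.Relation.Unary.All using (All)
import Data.List.Relation.Unary.All as All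
open import Data.List.Relation.Unary.Unique.Propositional using (Unique)
open import Data.List.Relation.Unary.Unique.Propositional.Properties using (map⁺)
open import Data.Nat using (ℕ; suc; _+_; _≥_)
open import Data.Product using (_,_; proj₁; proj₂)
open import Function using (_∘_)
open import Function.Bundles using (mk⇔)
open import Level using (Level)
open import Relation.Nullary using (yes; no)
open import Relation.Unary using (Pred; Decidable; _≐_)
open import Relation.Binary.PropositionalEquality
  using (_≡_; refl; sym; trans; cong; cong₂; subst; module ≡-Reasoning)

private
  variable
    a p q : Level
    A B : Set a

length-filter-map : {P : Pred A p} {Q : Pred B q} (P? : Decidable P) (Q? : Decidable Q)
                    (f : A → B) → P ≐ Q ∘ f →
                    ∀ xs → length (filter Q? (map f xs)) ≡ length (filter P? xs)
length-filter-map P? Q? f P≐Qf [] = refl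
length-filter-map P? Q? f P≐Qf (x ∷ xs) with P? x
... | yes Px = trans (cong length (filter-accept Q? (proj₁ P≐Qf Px)))
                     (cong suc (length-filter-map P? Q? f P≐Qf xs))
... | no ¬Px = trans (cong length (filter-reject Q? (¬Px ∘ proj₂ P≐Qf)))
                     (length-filter-map P? Q? f P≐Qf xs)

involution-map-↭ : (f : A → A) → (∀ x → f (f x) ≡ x) →
                   ∀ {xs} → Unique xs → (∀ {x} → x ∈ xs → f x ∈ xs) → map f xs ↭ xs
involution-map-↭ f f∘f≡id {xs} unique closed =
  ∼bag⇒↭ (unique∧set⇒bag (map⁺ f-injective unique) unique (mk⇔ to from))
  where
  f-injective : ∀ {x y} → f x ≡ f y → x ≡ y
  f-injective {x} {y} fx≡fy = trans (sym (f∘f≡id x)) (trans (cong f fx≡fy) (f∘f≡id y))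

  to : ∀ {y} → y ∈ map f xs → y ∈ xs
  to y∈ with ∈-map⁻ f y∈
  ... | x , x∈xs , refl = closed x∈xs

  from : ∀ {x} → x ∈ xs → x ∈ map f xs
  from {x} x∈xs = subst (_∈ map f xs) (f∘f≡id x) (∈-map⁺ f (closed x∈xs))

coeff-map : {f g h f′ g′ h′ : Tree → ℕ} (φ : Tree → Tree) →
            (∀ T → (f′ (φ T) , g′ (φ T) , h′ (φ T)) ≡ (f T , g T , h T)) →
            ∀ L a b c → coeff f′ g′ h′ (map φ L) a b c ≡ coeff f g h L a b c
coeff-map φ stats-φ L a b c =
  length-filter-map _ _ φ (trans (stats-φ _) , trans (sym (stats-φ _))) L

coeff-↭ : {f g h : Tree → ℕ} {L L′ : List Tree} → L ↭ L′ →
          ∀ a b c → coeff f g h L a b c ≡ coeff f g h L′ a b c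
coeff-↭ L↭L′ a b c = ↭-length (filter-↭ _ L↭L′)

children : Tree → List Tree
children (node ts) = ts

rotate : List Tree → List Tree
rotate []       = []
rotate (t ∷ ts) = node ts ∷ children t

mutual
  ψ-children : List Tree → List Tree
  ψ-children []              = []
  ψ-children (node K ∷ rest) = node (map-ψ-rotate rest) ∷ rotate (map-ψ K)

  map-ψ : List Tree → List Tree
  map-ψ []             = []
  map-ψ (node ts ∷ us) = node (ψ-children ts) ∷ map-ψ us

  -- map-ψ ∘ rotate, unfolded one step so that the recursion is structural
  map-ψ-rotate : List Tree → List Tree
  map-ψ-rotate []             = []
  map-ψ-rotate (node ts ∷ us) = node (ψ-children us) ∷ map-ψ ts

ψ : Tree → Tree
ψ (node ts) = node (ψ-children ts)

mutual
  ψ-children-involutive : ∀ ts → ψ-children (ψ-children ts) ≡ ts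
  ψ-children-involutive []              = refl
  ψ-children-involutive (node K ∷ rest) =
    cong₂ (λ K′ rest′ → node K′ ∷ rest′)
      (map-ψ-rotate-rotate-map-ψ K) (rotate-map-ψ-map-ψ-rotate rest)

  map-ψ-involutive : ∀ ts → map-ψ (map-ψ ts) ≡ ts
  map-ψ-involutive []             = refl
  map-ψ-involutive (node ts ∷ us) =
    cong₂ (λ ts′ us′ → node ts′ ∷ us′) (ψ-children-involutive ts) (map-ψ-involutive us)

  map-ψ-rotate-rotate-map-ψ : ∀ ts → map-ψ-rotate (rotate (map-ψ ts)) ≡ ts
  map-ψ-rotate-rotate-map-ψ []             = refl
  map-ψ-rotate-rotate-map-ψ (node ts ∷ us) =
    cong₂ (λ ts′ us′ → node ts′ ∷ us′) (ψ-children-involutive ts) (map-ψ-involutive us)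

  rotate-map-ψ-map-ψ-rotate : ∀ ts → rotate (map-ψ (map-ψ-rotate ts)) ≡ ts
  rotate-map-ψ-map-ψ-rotate []             = refl
  rotate-map-ψ-map-ψ-rotate (node ts ∷ us) =
    cong₂ (λ ts′ us′ → node ts′ ∷ us′) (map-ψ-involutive ts) (ψ-children-involutive us)

ψ-involutive : ∀ t → ψ (ψ t) ≡ t
ψ-involutive (node ts) = cong node (ψ-children-involutive ts)

oeF eeF : List Tree → ℕ
oeF = evenDegAtF false
eeF = evenDegAtF true

𝟙odd 𝟙even : ℕ → ℕ
𝟙odd n  = one? (isOdd n)
𝟙even n = one? (isEven n)

𝟙even-suc : ∀ n → 𝟙even (suc n) ≡ 𝟙odd n
𝟙even-suc n = cong one? (not-involutive (isOdd n))

edgesF-rotate : ∀ ts → edgesF (rotate ts) ≡ edgesF ts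
edgesF-rotate []              = refl
edgesF-rotate (node us ∷ ts) = cong suc (+-comm (edgesF ts) (edgesF us))

oddF-rotate : ∀ ts →
              𝟙even (length (rotate ts)) + oddF (rotate ts) ≡ 𝟙even (length ts) + oddF ts
oddF-rotate []              = refl
oddF-rotate (node us ∷ ts) =
  trans (split us ts) (trans (+-comm (odd (node us)) (odd (node ts))) (sym (split ts us)))
  where
  split : ∀ us ts →
          𝟙even (suc (length us)) + (odd (node ts) + oddF us) ≡ odd (node us) + odd (node ts)
  split us ts = trans (cong₂ _+_ (𝟙even-suc (length us)) refl)
                      (x∙yz≈xz∙y (𝟙odd (length us)) (odd (node ts)) (oddF us))

oeF-rotate : ∀ ts → 𝟙odd (length (rotate ts)) + oeF (rotate ts) ≡ eeF ts
oeF-rotate []              = refl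
oeF-rotate (node us ∷ ts) = x∙yz≈xz∙y (𝟙even (length us)) (eeF ts) (oeF us)

eeF-rotate : ∀ ts → eeF (rotate ts) ≡ 𝟙odd (length ts) + oeF ts
eeF-rotate []              = refl
eeF-rotate (node us ∷ ts) = sym (x∙yz≈xz∙y (𝟙even (length ts)) (eeF us) (oeF ts))

record OddOeSwapped (s t : Tree) : Set where
  field
    edges≡  : edges t ≡ edges s
    odd≡oe  : odd t ≡ oe s
    oe≡odd  : oe t ≡ odd s
    ee≡     : ee t ≡ ee s

record OddOeSwappedF (ss ts : List Tree) : Set where
  field
    length≡   : length ts ≡ length ss
    edgesF≡   : edgesF ts ≡ edgesF ss
    oddF≡oeF  : oddF ts ≡ oeF ss
    oeF≡oddF  : oeF ts ≡ oddF ss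
    eeF≡      : eeF ts ≡ eeF ss

[]-oddOeSwapped : OddOeSwappedF [] []
[]-oddOeSwapped = record
  { length≡ = refl ; edgesF≡ = refl ; oddF≡oeF = refl ; oeF≡oddF = refl ; eeF≡ = refl }

∷-oddOeSwapped : ∀ {s t ss ts} → OddOeSwapped s t → OddOeSwappedF ss ts →
                 OddOeSwappedF (s ∷ ss) (t ∷ ts)
∷-oddOeSwapped st ss-ts = record
  { length≡  = cong suc (length≡ ss-ts)
  ; edgesF≡  = cong suc (cong₂ _+_ (edges≡ st) (edgesF≡ ss-ts))
  ; oddF≡oeF = cong₂ _+_ (odd≡oe st) (oddF≡oeF ss-ts)
  ; oeF≡oddF = cong₂ _+_ (oe≡odd st) (oeF≡oddF ss-ts)
  ; eeF≡     = cong₂ _+_ (ee≡ st) (eeF≡ ss-ts)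
  }
  where open OddOeSwapped; open OddOeSwappedF

node-oddOeSwapped : ∀ {K rest M R} → OddOeSwappedF K M → OddOeSwappedF (rotate rest) R →
                    OddOeSwapped (node (node K ∷ rest)) (node (node R ∷ rotate M))
node-oddOeSwapped {K} {rest} {M} {R} K-M rest-R = record
  { edges≡ = cong suc (trans (cong₂ _+_ edges-R edges-F) (+-comm (edgesF rest) (edgesF K)))
  ; odd≡oe = begin
      𝟙even (length F) + (odd (node R) + oddF F)
        ≡⟨ x∙yz≈xz∙y (𝟙even (length F)) (odd (node R)) (oddF F) ⟩
      (𝟙even (length F) + oddF F) + odd (node R)
        ≡⟨ cong₂ _+_ odd-F odd-R ⟩
      ee (node K) + eeF rest
        ∎
  ; oe≡odd = begin
      (𝟙even (length R) + oeF R) + eeF F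
        ≡⟨ cong₂ _+_ oe-R ee-F ⟩
      (𝟙even (length rest) + oddF rest) + odd (node K)
        ≡⟨ xy∙z≈x∙zy (𝟙even (length rest)) (oddF rest) (odd (node K)) ⟩
      𝟙even (length rest) + (odd (node K) + oddF rest)
        ≡⟨⟩
      odd (node (node K ∷ rest))
        ∎
  ; ee≡ = begin
      𝟙even (suc (length F)) + (eeF R + oeF F)
        ≡⟨ cong₂ _+_ (𝟙even-suc (length F)) refl ⟩
      𝟙odd (length F) + (eeF R + oeF F)
        ≡⟨ x∙yz≈y∙xz (𝟙odd (length F)) (eeF R) (oeF F) ⟩
      eeF R + (𝟙odd (length F) + oeF F)
        ≡⟨ cong₂ _+_ ee-R oe-F ⟩
      (𝟙odd (length rest) + oeF rest) + eeF K
        ≡⟨ xy∙z≈x∙zy (𝟙odd (length rest)) (oeF rest) (eeF K) ⟩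
      𝟙odd (length rest) + (eeF K + oeF rest)
        ≡⟨ cong₂ _+_ (𝟙even-suc (length rest)) refl ⟨
      ee (node (node K ∷ rest))
        ∎
  }
  where
  open ≡-Reasoning
  open OddOeSwappedF
  F = rotate M

  edges-R : edgesF R ≡ edgesF rest
  edges-R = trans (edgesF≡ rest-R) (edgesF-rotate rest)
  edges-F : edgesF F ≡ edgesF K
  edges-F = trans (edgesF-rotate M) (edgesF≡ K-M)

  odd-R : odd (node R) ≡ eeF rest
  odd-R = trans (cong₂ _+_ (cong 𝟙odd (length≡ rest-R)) (oddF≡oeF rest-R)) (oeF-rotate rest)
  odd-F : 𝟙even (length F) + oddF F ≡ ee (node K)
  odd-F = trans (oddF-rotate M) (cong₂ _+_ (cong 𝟙even (length≡ K-M)) (oddF≡oeF K-M))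

  oe-R : 𝟙even (length R) + oeF R ≡ 𝟙even (length rest) + oddF rest
  oe-R = trans (cong₂ _+_ (cong 𝟙even (length≡ rest-R)) (oeF≡oddF rest-R)) (oddF-rotate rest)
  ee-F : eeF F ≡ odd (node K)
  ee-F = trans (eeF-rotate M) (cong₂ _+_ (cong 𝟙odd (length≡ K-M)) (oeF≡oddF K-M))

  ee-R : eeF R ≡ 𝟙odd (length rest) + oeF rest
  ee-R = trans (eeF≡ rest-R) (eeF-rotate rest)
  oe-F : 𝟙odd (length F) + oeF F ≡ eeF K
  oe-F = trans (oeF-rotate M) (eeF≡ K-M)

mutual
  ψ-children-oddOeSwapped : ∀ ts → OddOeSwapped (node ts) (node (ψ-children ts))
  ψ-children-oddOeSwapped []              =
    record { edges≡ = refl ; odd≡oe = refl ; oe≡odd = refl ; ee≡ = refl }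
  ψ-children-oddOeSwapped (node K ∷ rest) =
    node-oddOeSwapped (map-ψ-oddOeSwapped K) (map-ψ-rotate-oddOeSwapped rest)

  map-ψ-oddOeSwapped : ∀ ts → OddOeSwappedF ts (map-ψ ts)
  map-ψ-oddOeSwapped []             = []-oddOeSwapped
  map-ψ-oddOeSwapped (node ts ∷ us) =
    ∷-oddOeSwapped (ψ-children-oddOeSwapped ts) (map-ψ-oddOeSwapped us)

  map-ψ-rotate-oddOeSwapped : ∀ ts → OddOeSwappedF (rotate ts) (map-ψ-rotate ts)
  map-ψ-rotate-oddOeSwapped []             = []-oddOeSwapped
  map-ψ-rotate-oddOeSwapped (node ts ∷ us) =
    ∷-oddOeSwapped (ψ-children-oddOeSwapped us) (map-ψ-oddOeSwapped ts)

edges-ψ : ∀ t → edges (ψ t) ≡ edges t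
edges-ψ (node ts) = OddOeSwapped.edges≡ (ψ-children-oddOeSwapped ts)

stats-ψ : ∀ t → (oe (ψ t) , odd (ψ t) , ee (ψ t)) ≡ (odd t , oe t , ee t)
stats-ψ (node ts) = cong₂ _,_ oe≡odd (cong₂ _,_ odd≡oe ee≡)
  where open OddOeSwapped (ψ-children-oddOeSwapped ts)

corollary2p1 : (n : ℕ) → n ≥ 1 →
    (L : List Tree) → All (λ T → edges T ≡ n) L → Unique L →
    ((T : Tree) → edges T ≡ n → T ∈ L) →
    (a b c : ℕ) → coeff odd oe ee L a b c ≡ coeff oe odd ee L a b c
corollary2p1 n _ L edges≡n unique complete a b c = begin
  coeff odd oe ee L a b c
    ≡⟨ coeff-map ψ stats-ψ L a b c ⟨
  coeff oe odd ee (map ψ L) a b c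
    ≡⟨ coeff-↭ (involution-map-↭ ψ ψ-involutive unique ψ-closed) a b c ⟩
  coeff oe odd ee L a b c
    ∎
  where
  open ≡-Reasoning
  ψ-closed : ∀ {T} → T ∈ L → ψ T ∈ L
  ψ-closed {T} T∈L = complete (ψ T) (trans (edges-ψ T) (All.lookup edges≡n T∈L))
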